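{- $L_0(\leq,\mathbin{;})$ is exactly the class of ordered semigroups.
   Context: For a non-empty set $X$ and $0\notin X$, let $X_0=X\cup\{0\}$ and let $\mathrm{Ltrel}_0(X)$ be the set of left total binary relations $\rho$ on $X_0$ (domain all of $X_0$) such that for all $s\in X_0$, $(0,s)\in\rho$ iff $s=0$. Relational composition is $s\mathbin{;}t=\{(x,y):\exists z((x,z)\in s\wedge(z,y)\in t)\}$. $L_0(\leq,\mathbin{;})$ is the closure under isomorphism of the class of structures $(B,\subseteq,\mathbin{;})$ with $B\subseteq\mathrm{Ltrel}_0(X)$ for some $X$ closed under $\mathbin{;}$. An ordered semigroup is $(A,\leq,\cdot)$ with $\cdot$ associative, $\leq$ a partial order and $\cdot$ monotone in each argument. -}

module Defs where

open import Data.Maybe using (Maybe; just; nothing)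
open import Data.Product using (Σ; ∃; _×_; _,_)
open import Relation.Binary.Core using (Rel)
open import Relation.Binary.Structures using (IsPartialOrder)
open import Relation.Binary.PropositionalEquality using (_≡_)
open import Algebra.Definitions using (Associative)
open import Function.Bundles using (_⇔_)
import Level

record IsOrderedSemigroup {A : Set} (_≤_ : Rel A Level.zero) (_·_ : A → A → A) : Set where
  field
    isPartialOrder : IsPartialOrder _≡_ _≤_
    assoc          : Associative _≡_ _·_
    monoˡ          : ∀ {a b} c → a ≤ b → (a · c) ≤ (b · c)
    monoʳ          : ∀ {a b} c → a ≤ b → (c · a) ≤ (c · b)

-- X₀ = X ∪ {0}, with 0 represented by nothing (so 0 ∉ X automatically).
X₀ : Set → Set
X₀ X = Maybe X

BRel : Set → Set₁
BRel X = X₀ X → X₀ X → Set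

_⨾_ : ∀ {X} → BRel X → BRel X → BRel X
(s ⨾ t) x y = ∃ λ z → s x z × t z y

_⊆ᴿ_ : ∀ {X} → BRel X → BRel X → Set
s ⊆ᴿ t = ∀ x y → s x y → t x y

_≐ᴿ_ : ∀ {X} → BRel X → BRel X → Set
s ≐ᴿ t = ∀ x y → (s x y ⇔ t x y)

record IsLtrel₀ {X : Set} (ρ : BRel X) : Set where
  field
    leftTotal : ∀ x → ∃ λ y → ρ x y
    zeroRow   : ∀ s → (ρ nothing s ⇔ (s ≡ nothing))

-- (A, ≤, ·) ∈ L₀(≤, ;): isomorphic to some (B, ⊆, ;) with B ⊆ Ltrel₀(X),
-- X non-empty, B closed under ;.  We take B to be the image of an
-- injective map f : A → Ltrel₀(X); f is an isomorphism onto B iff it is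
-- injective (up to relation equality), preserves · as ;, and reflects and
-- preserves the order; closure of B under ; then follows from preservation.
record L₀Representation (X : Set) {A : Set} (_≤_ : Rel A Level.zero) (_·_ : A → A → A) : Set₁ where
  field
    inhabitant : X
    f          : A → BRel X
    f-Ltrel₀   : ∀ a → IsLtrel₀ (f a)
    f-injective : ∀ a b → f a ≐ᴿ f b → a ≡ b
    f-hom      : ∀ a b → f (a · b) ≐ᴿ (f a ⨾ f b)
    f-order    : ∀ a b → (a ≤ b ⇔ (f a ⊆ᴿ f b))

InL₀ : {A : Set} (_≤_ : Rel A Level.zero) (_·_ : A → A → A) → Set₁
InL₀ {A} _≤_ _·_ = Σ Set λ X → L₀Representation X _≤_ _·_

-- Relations under ⊆ and ; already form an ordered semigroup, and a faithful
-- order embedding transports its laws.  Conversely, an ordered semigroup A acts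
-- on X = A¹ = A ∪ {1} by the down-closed right Cayley relations
-- ρ a = {(u , v) : v ≤ u a} ∪ {(0 , 0)}.  Then ρ a ; ρ b = ρ (a b), since u a is
-- always a valid intermediate point, and the row of 1 in ρ a is the down-set
-- of a, so ρ reflects the order.

module Submission where

open import Defs
import Level
open import Relation.Binary.Core using (Rel)
open import Relation.Binary.Bundles using (Preorder)
open import Relation.Binary.Structures using (IsPartialOrder)
open import Relation.Binary.PropositionalEquality
  using (_≡_; refl; sym; subst; isEquivalence)
open import Function.Bundles using (_⇔_; mk⇔; Equivalence)
open import Data.Product using (_×_; _,_)
open import Data.Maybe using (Maybe; just; nothing)
open import Data.Unit using (⊤; tt)
open import Data.Empty using (⊥)
open Equivalence using (to; from)

module _ {X : Set} where

  ⊆ᴿ-refl : {s : BRel X} → s ⊆ᴿ s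
  ⊆ᴿ-refl x y p = p

  ⊆ᴿ-trans : {s t u : BRel X} → s ⊆ᴿ t → t ⊆ᴿ u → s ⊆ᴿ u
  ⊆ᴿ-trans s⊆t t⊆u x y p = t⊆u x y (s⊆t x y p)

  ⊆ᴿ-antisym : {s t : BRel X} → s ⊆ᴿ t → t ⊆ᴿ s → s ≐ᴿ t
  ⊆ᴿ-antisym s⊆t t⊆s x y = mk⇔ (s⊆t x y) (t⊆s x y)

  ≐ᴿ⇒⊆ᴿ : {s t : BRel X} → s ≐ᴿ t → s ⊆ᴿ t
  ≐ᴿ⇒⊆ᴿ s≐t x y = to (s≐t x y)

  ≐ᴿ-refl : {s : BRel X} → s ≐ᴿ s
  ≐ᴿ-refl = ⊆ᴿ-antisym ⊆ᴿ-refl ⊆ᴿ-refl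

  ≐ᴿ-sym : {s t : BRel X} → s ≐ᴿ t → t ≐ᴿ s
  ≐ᴿ-sym s≐t x y = mk⇔ (from (s≐t x y)) (to (s≐t x y))

  ≐ᴿ-trans : {s t u : BRel X} → s ≐ᴿ t → t ≐ᴿ u → s ≐ᴿ u
  ≐ᴿ-trans s≐t t≐u = ⊆ᴿ-antisym (⊆ᴿ-trans (≐ᴿ⇒⊆ᴿ s≐t) (≐ᴿ⇒⊆ᴿ t≐u))
                                (⊆ᴿ-trans (≐ᴿ⇒⊆ᴿ (≐ᴿ-sym t≐u)) (≐ᴿ⇒⊆ᴿ (≐ᴿ-sym s≐t)))

  ⊆ᴿ-preorder : Preorder (Level.suc Level.zero) Level.zero Level.zero
  ⊆ᴿ-preorder = record
    { Carrier    = BRel X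
    ; _≈_        = _≐ᴿ_
    ; _≲_        = _⊆ᴿ_
    ; isPreorder = record
      { isEquivalence = record { refl = ≐ᴿ-refl ; sym = ≐ᴿ-sym ; trans = ≐ᴿ-trans }
      ; reflexive = ≐ᴿ⇒⊆ᴿ
      ; trans     = ⊆ᴿ-trans
      }
    }

  ⨾-mono : {s s′ t t′ : BRel X} → s ⊆ᴿ s′ → t ⊆ᴿ t′ → (s ⨾ t) ⊆ᴿ (s′ ⨾ t′)
  ⨾-mono s⊆s′ t⊆t′ x y (z , p , q) = z , s⊆s′ x z p , t⊆t′ z y q

  ⨾-cong : {s s′ t t′ : BRel X} → s ≐ᴿ s′ → t ≐ᴿ t′ → (s ⨾ t) ≐ᴿ (s′ ⨾ t′)
  ⨾-cong s≐s′ t≐t′ = ⊆ᴿ-antisym (⨾-mono (≐ᴿ⇒⊆ᴿ s≐s′) (≐ᴿ⇒⊆ᴿ t≐t′))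
                                (⨾-mono (≐ᴿ⇒⊆ᴿ (≐ᴿ-sym s≐s′)) (≐ᴿ⇒⊆ᴿ (≐ᴿ-sym t≐t′)))

  ⨾-assoc : (s t u : BRel X) → ((s ⨾ t) ⨾ u) ≐ᴿ (s ⨾ (t ⨾ u))
  ⨾-assoc s t u x y = mk⇔ (λ { (z , (w , p , q) , r) → w , p , z , q , r })
                          (λ { (w , p , z , q , r) → z , (w , p , q) , r })

module _ {X A : Set} {_≤_ : Rel A Level.zero} {_·_ : A → A → A}
         (R : L₀Representation X _≤_ _·_) where
  open L₀Representation R
  open import Relation.Binary.Reasoning.Preorder (⊆ᴿ-preorder {X})

  L₀Representation⇒isOrderedSemigroup : IsOrderedSemigroup _≤_ _·_
  L₀Representation⇒isOrderedSemigroup = record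
    { isPartialOrder = record
      { isPreorder = record
        { isEquivalence = isEquivalence
        ; reflexive     = λ { refl → f-reflects ⊆ᴿ-refl }
        ; trans         = λ a≤b b≤c → f-reflects (⊆ᴿ-trans (f-mono a≤b) (f-mono b≤c))
        }
      ; antisym = λ a≤b b≤a → f-injective _ _ (⊆ᴿ-antisym (f-mono a≤b) (f-mono b≤a))
      }
    ; assoc = assoc
    ; monoˡ = λ _ a≤b → ·-mono (f-mono a≤b) ⊆ᴿ-refl
    ; monoʳ = λ _ a≤b → ·-mono ⊆ᴿ-refl (f-mono a≤b)
    }
    where
    f-mono : {a b : A} → a ≤ b → f a ⊆ᴿ f b
    f-mono = to (f-order _ _)

    f-reflects : {a b : A} → f a ⊆ᴿ f b → a ≤ b
    f-reflects = from (f-order _ _)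

    assoc : (a b c : A) → (a · b) · c ≡ a · (b · c)
    assoc a b c = f-injective _ _ (begin-equality
      f ((a · b) · c)        ≈⟨ f-hom (a · b) c ⟩
      f (a · b) ⨾ f c        ≈⟨ ⨾-cong (f-hom a b) ≐ᴿ-refl ⟩
      (f a ⨾ f b) ⨾ f c      ≈⟨ ⨾-assoc (f a) (f b) (f c) ⟩
      f a ⨾ (f b ⨾ f c)      ≈⟨ ⨾-cong ≐ᴿ-refl (f-hom b c) ⟨
      f a ⨾ f (b · c)        ≈⟨ f-hom a (b · c) ⟨
      f (a · (b · c))        ∎)

    ·-mono : {a a′ b b′ : A} → f a ⊆ᴿ f a′ → f b ⊆ᴿ f b′ → (a · b) ≤ (a′ · b′)
    ·-mono {a} {a′} {b} {b′} a⊆a′ b⊆b′ = f-reflects (begin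
      f (a · b)              ≈⟨ f-hom a b ⟩
      f a ⨾ f b              ≲⟨ ⨾-mono a⊆a′ b⊆b′ ⟩
      f a′ ⨾ f b′            ≈⟨ f-hom a′ b′ ⟨
      f (a′ · b′)            ∎)

module _ {A : Set} {_≤_ : Rel A Level.zero} {_·_ : A → A → A}
         (isOS : IsOrderedSemigroup _≤_ _·_) where
  open IsOrderedSemigroup isOS
  open IsPartialOrder isPartialOrder using (antisym) renaming (refl to ≤-refl; trans to ≤-trans)

  -- A¹ = Maybe A, with nothing the adjoined identity 1.
  _·¹_ : Maybe A → A → A
  nothing ·¹ a = a
  just u  ·¹ a = u · a

  ·¹-assoc : ∀ u a b → (u ·¹ a) · b ≡ u ·¹ (a · b)
  ·¹-assoc nothing  a b = refl
  ·¹-assoc (just u) a b = assoc u a b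

  ·¹-monoʳ : ∀ u {a b} → a ≤ b → (u ·¹ a) ≤ (u ·¹ b)
  ·¹-monoʳ nothing  a≤b = a≤b
  ·¹-monoʳ (just u) a≤b = monoʳ u a≤b

  -- X₀ (Maybe A) = Maybe (Maybe A): nothing is 0 and just nothing is 1.
  cayley : A → BRel (Maybe A)
  cayley a nothing  nothing         = ⊤
  cayley a (just u) (just (just v)) = v ≤ (u ·¹ a)
  cayley a _        _               = ⊥

  cayley-isLtrel₀ : ∀ a → IsLtrel₀ (cayley a)
  cayley-isLtrel₀ a = record
    { leftTotal = λ { nothing  → nothing , tt
                    ; (just u) → just (just (u ·¹ a)) , ≤-refl }
    ; zeroRow   = λ { nothing  → mk⇔ (λ _ → refl) (λ _ → tt)
                    ; (just _) → mk⇔ (λ ()) (λ ()) }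
    }

  cayley-mono : ∀ {a b} → a ≤ b → cayley a ⊆ᴿ cayley b
  cayley-mono a≤b nothing  nothing         tt   = tt
  cayley-mono a≤b (just u) (just (just v)) v≤ua = ≤-trans v≤ua (·¹-monoʳ u a≤b)

  cayley-reflects : ∀ {a b} → cayley a ⊆ᴿ cayley b → a ≤ b
  cayley-reflects {a} a⊆b = a⊆b (just nothing) (just (just a)) ≤-refl

  cayley-hom : ∀ a b → cayley (a · b) ≐ᴿ (cayley a ⨾ cayley b)
  cayley-hom a b = ⊆ᴿ-antisym hom⊆ hom⊇
    where
    hom⊆ : cayley (a · b) ⊆ᴿ (cayley a ⨾ cayley b)
    hom⊆ nothing  nothing         tt      = nothing , tt , tt
    hom⊆ (just u) (just (just v)) v≤u·ab  =
      just (just (u ·¹ a)) , ≤-refl , subst (v ≤_) (sym (·¹-assoc u a b)) v≤u·ab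

    hom⊇ : (cayley a ⨾ cayley b) ⊆ᴿ cayley (a · b)
    hom⊇ nothing  nothing         _                              = tt
    hom⊇ nothing  (just _)        (nothing , _ , ())
    hom⊇ (just u) nothing         (just (just _) , _ , ())
    hom⊇ (just u) (just nothing)  (just (just _) , _ , ())
    hom⊇ (just u) (just (just v)) (just (just w) , w≤ua , v≤wb)  =
      subst (v ≤_) (·¹-assoc u a b) (≤-trans v≤wb (monoˡ b w≤ua))

  isOrderedSemigroup⇒L₀Representation : L₀Representation (Maybe A) _≤_ _·_
  isOrderedSemigroup⇒L₀Representation = record
    { inhabitant  = nothing
    ; f           = cayley
    ; f-Ltrel₀    = cayley-isLtrel₀
    ; f-injective = λ _ _ a≐b → antisym (cayley-reflects (≐ᴿ⇒⊆ᴿ a≐b))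
                                         (cayley-reflects (≐ᴿ⇒⊆ᴿ (≐ᴿ-sym a≐b)))
    ; f-hom       = cayley-hom
    ; f-order     = λ _ _ → mk⇔ cayley-mono cayley-reflects
    }

mainTheorem5 : (A : Set) (_≤_ : Rel A Level.zero) (_·_ : A → A → A) →
    (InL₀ _≤_ _·_ → IsOrderedSemigroup _≤_ _·_) × (IsOrderedSemigroup _≤_ _·_ → InL₀ _≤_ _·_)
mainTheorem5 A _≤_ _·_ =
  (λ { (_ , R) → L₀Representation⇒isOrderedSemigroup R }) ,
  (λ isOS → Maybe A , isOrderedSemigroup⇒L₀Representation isOS)
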